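{- Let $a,b,c$ be positive integers. If a graph $G$ realizes $(a,b,c,1)$, then some vertex of corner rank $3$ or $4$ is adjacent to every vertex of corner rank $2$.
   Context: All graphs are finite, nonempty, simple and reflexive. Corner ranking: $N[v]$ is the closed neighborhood. In a graph $H$, $w$ strictly corners a distinct vertex $v$ if $N[v]\subsetneq N[w]$. Set $G^{(1)}=G$, $k=1$. If $G^{(k)}$ is a clique, give its vertices rank $k$ and stop; else if it has no strict corners, give its vertices rank $\infty$ and stop; else give all strict corners of $G^{(k)}$ rank $k$, delete them to get $G^{(k+1)}$, increase $k$, repeat. The corner rank $\alpha$ is the largest vertex rank; cop-win graphs are those with finite corner rank. The rank cardinality vector of $G$ is $(x_\alpha,\ldots,x_1)$, $x_k$ the number of vertices of rank $k$; a cop-win graph realizes its rank cardinality vector. -}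

module Defs where

open import Data.Nat using (ℕ; zero; suc; _≤_; _∸_; NonZero)
open import Data.Fin using (Fin; toℕ)
open import Data.Bool using (Bool; true; false; _∧_; _∨_; not; T)
open import Data.List using (List; []; _∷_; length; allFin; filter; lookup)
open import Data.Bool.ListAction using (all; any)
open import Data.Bool.Properties using (T?)
open import Data.Product using (Σ; ∃; _×_; _,_)
open import Relation.Binary.PropositionalEquality using (_≡_)

record Graph : Set where
  field
    n        : ℕ
    nonempty : NonZero n
    adj      : Fin n → Fin n → Bool
    adj-refl : ∀ v → adj v v ≡ true
    adj-sym  : ∀ u v → adj u v ≡ adj v u

module _ (G : Graph) where
  open Graph G

  -- a vertex subset (the vertex set of an induced subgraph)
  VSet : Set
  VSet = Fin n → Bool

  allV : (Fin n → Bool) → Bool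
  allV p = all p (allFin n)

  anyV : (Fin n → Bool) → Bool
  anyV p = any p (allFin n)

  -- closed neighbourhood in the induced subgraph on V: u ∈ N[v]
  inN : VSet → Fin n → Fin n → Bool
  inN V v u = V u ∧ adj v u

  nbhdSub : VSet → Fin n → Fin n → Bool
  nbhdSub V v w = allV (λ u → not (inN V v u) ∨ inN V w u)

  strictlyCorners : VSet → Fin n → Fin n → Bool
  strictlyCorners V w v = V v ∧ V w ∧ nbhdSub V v w ∧ not (nbhdSub V w v)

  isStrictCorner : VSet → Fin n → Bool
  isStrictCorner V v = anyV (λ w → strictlyCorners V w v)

  isClique : VSet → Bool
  isClique V = allV (λ u → allV (λ v → not (V u ∧ V v) ∨ adj u v))

  -- stage k = vertex set of G^(k+1)
  stage : ℕ → VSet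
  stage zero    v = true
  stage (suc k) v = stage k v ∧ not (isStrictCorner (stage k) v)

  -- G^(j+1) is the first clique among G^(1),…,G^(j+1) (given it is a clique)
  firstClique : ℕ → Bool
  firstClique zero    = true
  firstClique (suc j) = not (isClique (stage j))

  hasRank : ℕ → Fin n → Bool
  hasRank zero    v = false
  hasRank (suc j) v =
    stage j v ∧ (isStrictCorner (stage j) v ∨ (isClique (stage j) ∧ firstClique j))

  rankCount : ℕ → ℕ
  rankCount k = length (filter (λ v → T? (hasRank k v)) (allFin n))

  CornerRankIs : ℕ → Set
  CornerRankIs α =
    (∀ v → ∃ λ k → (1 ≤ k) × (k ≤ α) × T (hasRank k v)) ×
    (∃ λ v → T (hasRank α v))

  -- G realizes the rank cardinality vector xs = (x_α, …, x_1)
  Realizes : List ℕ → Set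
  Realizes xs =
    CornerRankIs (length xs) ×
    (∀ (i : Fin (length xs)) → rankCount (length xs ∸ toℕ i) ≡ lookup xs i)

module Submission where

-- Let G realize (a, b, c, 1), so G has corner rank 4 and a unique vertex z of
-- rank 1.  Since ranks go up to 4, neither G nor G^(2) = G - z is a clique, so
-- the rank-1 vertices are the strict corners of G and the rank-2 vertices are
-- the strict corners of G^(2).
--
-- Key fact (`second-corner`): if w strictly corners u in G^(2), then u ~ z and
-- w ≁ z.  Otherwise N[u] ⊊ N[w] would already hold in G, making u a strict
-- corner of G, i.e. u = z, which is not a vertex of G^(2).
--
-- Hence every rank-2 vertex is adjacent to z.  Take w with N[z] ⊊ N[w] in G;
-- then w sees every rank-2 vertex.  If w has rank 3 or 4 we are done.  If w
-- has rank 2, some x corners w in G^(2); x ≁ z, so x has neither rank 1 nor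
-- rank 2, and N[w] ⊆ N[x] in G^(2) makes x see every rank-2 vertex too.

open import Defs
open import Data.Nat using (ℕ; zero; suc; _≤_; _+_; s≤s)
open import Data.Fin using (Fin; fromℕ)
open import Data.Bool using (Bool; true; false; T; _∧_; _∨_; not)
open import Data.Bool.Properties using (T?; T-∧; T-∨)
open import Data.List using ([]; _∷_; length; filter; allFin)
import Data.List.Relation.Unary.All as All
open import Data.List.Relation.Unary.All.Properties using (all⁺; all⁻)
open import Data.List.Relation.Unary.Any using (here; there; satisfied)
open import Data.List.Relation.Unary.Any.Properties using (any⁺; any⁻)
open import Data.List.Membership.Propositional using (_∈_; lose)
open import Data.List.Membership.Propositional.Properties
  using (∈-allFin; ∈-filter⁺; ∈-filter⁻)
open import Data.Product using (∃; _×_; _,_; proj₁; proj₂)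
open import Data.Sum using (_⊎_; inj₁; inj₂)
open import Data.Empty using (⊥-elim)
open import Function.Bundles using (Equivalence)
open import Relation.Nullary using (¬_; yes; no)
open import Relation.Unary using (Decidable)
open import Relation.Binary.PropositionalEquality using (_≡_; refl; sym; subst)

open Equivalence using (to; from)

⇒-elim : ∀ a c → T (not a ∨ c) → T a → T c
⇒-elim true c t _ = t

⇒-intro : ∀ a c → (T a → T c) → T (not a ∨ c)
⇒-intro false c _ = _
⇒-intro true  c h = h _

not-elim : ∀ {b} → T (not b) → ¬ T b
not-elim {true} ()

not-intro : ∀ {b} → ¬ T b → T (not b)
not-intro {false} _  = _
not-intro {true}  ¬b = ¬b _

unique-witness : ∀ {n} (p : Fin n → Bool) →
  length (filter (λ v → T? (p v)) (allFin n)) ≡ 1 →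
  ∃ λ z → T (p z) × (∀ x → T (p x) → x ≡ z)
unique-witness {n} p one with filter (λ v → T? (p v)) (allFin n) in eq | one
... | z ∷ [] | refl = z , proj₂ (∈-filter⁻ P? {xs = allFin n} z∈) , λ x px → only (x∈ x px)
  where
  P? : Decidable (λ v → T (p v))
  P? v = T? (p v)
  z∈ : z ∈ filter P? (allFin n)
  z∈ = subst (z ∈_) (sym eq) (here refl)
  x∈ : ∀ x → T (p x) → x ∈ z ∷ []
  x∈ x px = subst (x ∈_) eq (∈-filter⁺ P? (∈-allFin x) px)
  only : ∀ {x} → x ∈ z ∷ [] → x ≡ z
  only (here e) = e
  only (there ())

module CornerRanking (G : Graph) where
  open Graph G

  allV-elim : ∀ p → T (allV G p) → ∀ x → T (p x)
  allV-elim p t x = All.lookup (all⁺ p (allFin n) t) (∈-allFin x)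

  allV-intro : ∀ p → (∀ x → T (p x)) → T (allV G p)
  allV-intro p h = all⁻ p {xs = allFin n} (All.tabulate (λ {x} _ → h x))

  anyV-elim : ∀ p → T (anyV G p) → ∃ λ x → T (p x)
  anyV-elim p t = satisfied (any⁻ p (allFin n) t)

  anyV-intro : ∀ p x → T (p x) → T (anyV G p)
  anyV-intro p x px = any⁺ p (lose (∈-allFin x) px)

  _∈ᵥ_ : Fin n → VSet G → Set
  x ∈ᵥ V = T (V x)

  _~_ : Fin n → Fin n → Set
  u ~ v = T (adj u v)

  ~-sym : ∀ {u v} → u ~ v → v ~ u
  ~-sym {u} {v} = subst T (adj-sym u v)

  N⊆ : VSet G → Fin n → Fin n → Set
  N⊆ V v w = ∀ u → u ∈ᵥ V → v ~ u → w ~ u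

  Corners : VSet G → Fin n → Fin n → Set
  Corners V w v = v ∈ᵥ V × w ∈ᵥ V × N⊆ V v w × ¬ N⊆ V w v

  nbhdSub-elim : ∀ V v w → T (nbhdSub G V v w) → N⊆ V v w
  nbhdSub-elim V v w t u uV vu =
    proj₂ (to T-∧ (⇒-elim _ _ (allV-elim _ t u) (from T-∧ (uV , vu))))

  nbhdSub-intro : ∀ V v w → N⊆ V v w → T (nbhdSub G V v w)
  nbhdSub-intro V v w h = allV-intro _ λ u → ⇒-intro _ _ λ t →
    let uV , vu = to T-∧ t in from T-∧ (uV , h u uV vu)

  strictCorner-elim : ∀ V v → T (isStrictCorner G V v) → ∃ λ w → Corners V w v
  strictCorner-elim V v t with anyV-elim _ t
  ... | w , bits with to T-∧ bits
  ...   | vV , bits′ with to T-∧ bits′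
  ...     | wV , bits″ with to T-∧ bits″
  ...       | vw , ¬wv =
    w , vV , wV , nbhdSub-elim V v w vw , λ wv → not-elim ¬wv (nbhdSub-intro V w v wv)

  strictCorner-intro : ∀ V v w → Corners V w v → T (isStrictCorner G V v)
  strictCorner-intro V v w (vV , wV , vw , ¬wv) = anyV-intro _ w
    (from T-∧ (vV , from T-∧ (wV , from T-∧
      (nbhdSub-intro V v w vw , not-intro λ t → ¬wv (nbhdSub-elim V w v t)))))

  strictCorner-member : ∀ V v → T (isStrictCorner G V v) → v ∈ᵥ V
  strictCorner-member V v t = proj₁ (proj₂ (strictCorner-elim V v t))

  corners-irrefl : ∀ V v → ¬ Corners V v v
  corners-irrefl V v (_ , _ , _ , ¬vv) = ¬vv λ _ _ vu → vu

  clique-elim : ∀ V → T (isClique G V) → ∀ u v → u ∈ᵥ V → v ∈ᵥ V → u ~ v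
  clique-elim V c u v uV vV =
    ⇒-elim _ _ (allV-elim _ (allV-elim _ c u) v) (from T-∧ (uV , vV))

  clique-intro : ∀ V → (∀ u v → u ∈ᵥ V → v ∈ᵥ V → u ~ v) → T (isClique G V)
  clique-intro V h = allV-intro _ λ u → allV-intro _ λ v → ⇒-intro _ _ λ t →
    let uV , vV = to T-∧ t in h u v uV vV

  clique-subset : ∀ V V′ → (∀ x → x ∈ᵥ V′ → x ∈ᵥ V) →
    T (isClique G V) → T (isClique G V′)
  clique-subset V V′ V′⊆V c =
    clique-intro V′ λ u v uV′ vV′ → clique-elim V c u v (V′⊆V u uV′) (V′⊆V v vV′)

  -- In a clique all closed neighbourhoods coincide, so there are no strict corners.
  clique-noStrictCorner : ∀ V v → T (isClique G V) → ¬ T (isStrictCorner G V v)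
  clique-noStrictCorner V v c sc with strictCorner-elim V v sc
  ... | w , vV , _ , _ , ¬wv = ¬wv λ u uV _ → clique-elim V c v u vV uV

  N⊆-restrict : ∀ V V′ v w → (∀ x → x ∈ᵥ V′ → x ∈ᵥ V) → N⊆ V v w → N⊆ V′ v w
  N⊆-restrict V V′ v w V′⊆V vw u uV′ = vw u (V′⊆V u uV′)

  N⊆-extend : ∀ V V′ z v w → (∀ x → x ∈ᵥ V → ¬ x ∈ᵥ V′ → x ≡ z) →
    (v ~ z → w ~ z) → N⊆ V′ v w → N⊆ V v w
  N⊆-extend V V′ z v w only-z vz⇒wz vw u uV vu with T? (V′ u)
  ... | yes uV′ = vw u uV′ vu
  ... | no ¬uV′ with only-z u uV ¬uV′
  ...   | refl = vz⇒wz vu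

  corners-extend : ∀ V V′ z v w → (∀ x → x ∈ᵥ V′ → x ∈ᵥ V) →
    (∀ x → x ∈ᵥ V → ¬ x ∈ᵥ V′ → x ≡ z) →
    (v ~ z → w ~ z) → Corners V′ w v → Corners V w v
  corners-extend V V′ z v w V′⊆V only-z vz⇒wz (vV′ , wV′ , vw , ¬wv) =
    V′⊆V v vV′ , V′⊆V w wV′ , N⊆-extend V V′ z v w only-z vz⇒wz vw ,
    λ wv → ¬wv (N⊆-restrict V V′ w v V′⊆V wv)

  stage-shrinks : ∀ k x → x ∈ᵥ stage G (suc k) → x ∈ᵥ stage G k
  stage-shrinks k x t = proj₁ (to T-∧ t)

  stage-dropsCorner : ∀ k x → T (isStrictCorner G (stage G k) x) → ¬ x ∈ᵥ stage G (suc k)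
  stage-dropsCorner k x sc t = not-elim (proj₂ (to T-∧ t)) sc

  stage-left⇒corner : ∀ k x → x ∈ᵥ stage G k → ¬ x ∈ᵥ stage G (suc k) →
    T (isStrictCorner G (stage G k) x)
  stage-left⇒corner k x xk ¬xk′ with T? (isStrictCorner G (stage G k) x)
  ... | yes sc = sc
  ... | no ¬sc = ⊥-elim (¬xk′ (from T-∧ (xk , not-intro ¬sc)))

  clique-persists : ∀ j m → T (isClique G (stage G j)) → T (isClique G (stage G (m + j)))
  clique-persists j zero    c = c
  clique-persists j (suc m) c =
    clique-subset (stage G (m + j)) (stage G (suc m + j)) (stage-shrinks (m + j))
      (clique-persists j m c)

  noRankAfterClique : ∀ j m v → T (isClique G (stage G j)) →
    ¬ T (hasRank G (suc (suc (m + j))) v)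
  noRankAfterClique j m v c t with to T-∨ (proj₂ (to T-∧ t))
  ... | inj₁ sc = clique-noStrictCorner (stage G (suc m + j)) v (clique-persists j (suc m) c) sc
  ... | inj₂ p  = not-elim (proj₂ (to T-∧ p)) (clique-persists j m c)

  rank⇒corner : ∀ k v → ¬ T (isClique G (stage G k)) →
    T (hasRank G (suc k) v) → T (isStrictCorner G (stage G k) v)
  rank⇒corner k v ¬c t with to T-∨ (proj₂ (to T-∧ t))
  ... | inj₁ sc = sc
  ... | inj₂ p  = ⊥-elim (¬c (proj₁ (to T-∧ p)))

  corner⇒rank : ∀ k v → T (isStrictCorner G (stage G k) v) → T (hasRank G (suc k) v)
  corner⇒rank k v sc = from T-∧ (strictCorner-member (stage G k) v sc , from T-∨ (inj₁ sc))

  -- Suppose z is the unique strict corner of G, so that G^(2) = G - z.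
  module UniqueFirstCorner (z : Fin n)
    (z-corner : T (isStrictCorner G (stage G 0) z))
    (z-unique : ∀ x → T (isStrictCorner G (stage G 0) x) → x ≡ z) where

    z∉G₂ : ¬ z ∈ᵥ stage G 1
    z∉G₂ = stage-dropsCorner 0 z z-corner

    only-z-removed : ∀ x → x ∈ᵥ stage G 0 → ¬ x ∈ᵥ stage G 1 → x ≡ z
    only-z-removed x _ ¬x = z-unique x (stage-left⇒corner 0 x _ ¬x)

    second-corner : ∀ u w → Corners (stage G 1) w u → u ~ z × ¬ w ~ z
    second-corner u w cr@(uV , _) = u~z , λ w~z → cannot-lift λ _ → w~z
      where
      cannot-lift : ¬ (u ~ z → w ~ z)
      cannot-lift uz⇒wz = z∉G₂ (subst (_∈ᵥ stage G 1) u≡z uV)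
        where
        u≡z : u ≡ z
        u≡z = z-unique u (strictCorner-intro (stage G 0) u w
          (corners-extend (stage G 0) (stage G 1) z u w (λ _ _ → _) only-z-removed uz⇒wz cr))
      u~z : u ~ z
      u~z with T? (adj u z)
      ... | yes uz = uz
      ... | no ¬uz = ⊥-elim (cannot-lift λ uz → ⊥-elim (¬uz uz))

  module CornerRankFour (rank4 : CornerRankIs G 4) (one : rankCount G 1 ≡ 1) where

    HighRank : Fin n → Set
    HighRank x = T (hasRank G 3 x) ⊎ T (hasRank G 4 x)

    SeesRank2 : Fin n → Set
    SeesRank2 x = ∀ u → T (hasRank G 2 u) → x ~ u

    classify : ∀ v → T (hasRank G 1 v) ⊎ T (hasRank G 2 v) ⊎ HighRank v
    classify v with proj₁ rank4 v
    ... | 1 , _ , _ , t = inj₁ t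
    ... | 2 , _ , _ , t = inj₂ (inj₁ t)
    ... | 3 , _ , _ , t = inj₂ (inj₂ (inj₁ t))
    ... | 4 , _ , _ , t = inj₂ (inj₂ (inj₂ t))
    ... | suc (suc (suc (suc (suc _)))) , _ , s≤s (s≤s (s≤s (s≤s ()))) , _

    -- A vertex of rank 4 exists, so neither G nor G^(2) is a clique.
    G₁-notClique : ¬ T (isClique G (stage G 0))
    G₁-notClique c = noRankAfterClique 0 2 _ c (proj₂ (proj₂ rank4))

    G₂-notClique : ¬ T (isClique G (stage G 1))
    G₂-notClique c = noRankAfterClique 1 1 _ c (proj₂ (proj₂ rank4))

    unique-rank1 : ∃ λ z → T (hasRank G 1 z) × (∀ x → T (hasRank G 1 x) → x ≡ z)
    unique-rank1 = unique-witness (hasRank G 1) one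

    z : Fin n
    z = proj₁ unique-rank1

    rank1⇒z : ∀ x → T (hasRank G 1 x) → x ≡ z
    rank1⇒z = proj₂ (proj₂ unique-rank1)

    z-corner : T (isStrictCorner G (stage G 0) z)
    z-corner = rank⇒corner 0 z G₁-notClique (proj₁ (proj₂ unique-rank1))

    open UniqueFirstCorner z z-corner
      (λ x sc → rank1⇒z x (corner⇒rank 0 x sc))

    rank2-cornered : ∀ u → T (hasRank G 2 u) → ∃ λ w → Corners (stage G 1) w u
    rank2-cornered u t = strictCorner-elim (stage G 1) u (rank⇒corner 1 u G₂-notClique t)

    z-sees : SeesRank2 z
    z-sees u t = let w , cr = rank2-cornered u t in ~-sym (proj₁ (second-corner u w cr))

    sees-in-G₁ : ∀ v w → SeesRank2 v → N⊆ (stage G 0) v w → SeesRank2 w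
    sees-in-G₁ v w sv vw u t = vw u _ (sv u t)

    sees-in-G₂ : ∀ v w → SeesRank2 v → N⊆ (stage G 1) v w → SeesRank2 w
    sees-in-G₂ v w sv vw u t =
      vw u (strictCorner-member (stage G 1) u (rank⇒corner 1 u G₂-notClique t)) (sv u t)

    -- A rank-2 vertex seeing rank 2 is strictly cornered in G^(2) by a vertex x
    -- with x ≁ z; such an x has rank 3 or 4 and sees rank 2 as well.
    above-rank2 : ∀ w → T (hasRank G 2 w) → SeesRank2 w → ∃ λ x → HighRank x × SeesRank2 x
    above-rank2 w t sw = cornered-by (rank2-cornered w t)
      where
      by-rank : ∀ x → Corners (stage G 1) x w →
        T (hasRank G 1 x) ⊎ T (hasRank G 2 x) ⊎ HighRank x → ∃ λ x → HighRank x × SeesRank2 x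
      by-rank x (_ , xV , _) (inj₁ r1) =
        ⊥-elim (z∉G₂ (subst (_∈ᵥ stage G 1) (rank1⇒z x r1) xV))
      by-rank x cr (inj₂ (inj₁ r2)) = ⊥-elim (proj₂ (second-corner w x cr) (~-sym (z-sees x r2)))
      by-rank x (_ , _ , wx , _) (inj₂ (inj₂ hi)) = x , hi , sees-in-G₂ w x sw wx

      cornered-by : (∃ λ x → Corners (stage G 1) x w) → ∃ λ x → HighRank x × SeesRank2 x
      cornered-by (x , cr) = by-rank x cr (classify x)

    answer : ∃ λ x → HighRank x × SeesRank2 x
    answer = cornered-by (strictCorner-elim (stage G 0) z z-corner)
      where
      by-rank : ∀ w → Corners (stage G 0) w z →
        T (hasRank G 1 w) ⊎ T (hasRank G 2 w) ⊎ HighRank w → ∃ λ x → HighRank x × SeesRank2 x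
      by-rank w cr (inj₁ r1) =
        ⊥-elim (corners-irrefl (stage G 0) z
          (subst (λ y → Corners (stage G 0) y z) (rank1⇒z w r1) cr))
      by-rank w (_ , _ , zw , _) (inj₂ (inj₁ r2)) = above-rank2 w r2 (sees-in-G₁ z w z-sees zw)
      by-rank w (_ , _ , zw , _) (inj₂ (inj₂ hi)) = w , hi , sees-in-G₁ z w z-sees zw

      cornered-by : (∃ λ w → Corners (stage G 0) w z) → ∃ λ x → HighRank x × SeesRank2 x
      cornered-by (w , cr) = by-rank w cr (classify w)

lemma3p23 : (a b c : ℕ) → 1 ≤ a → 1 ≤ b → 1 ≤ c → (G : Graph) →
    Realizes G (a ∷ b ∷ c ∷ 1 ∷ []) →
    ∃ λ (w : Fin (Graph.n G)) →
    (T (hasRank G 3 w) ⊎ T (hasRank G 4 w)) ×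
    (∀ (u : Fin (Graph.n G)) → T (hasRank G 2 u) → T (Graph.adj G w u))
-- Realizing (a, b, c, 1) means corner rank 4 with exactly one vertex of rank 1.
lemma3p23 a b c _ _ _ G (rank4 , counts) =
  CornerRanking.CornerRankFour.answer G rank4 (counts (fromℕ 3))
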